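{- For integers $1\le i\le j$, in $\mathrm{Id}_\beta(W)[x,y]$ one has $[i,j]_x\,[j,i]_y=[j,i]_y\,[i,j]_x$, where $[i,j]_x:=h_i(x)h_{i+1}(x)\cdots h_j(x)$ and $[j,i]_y:=h_j(y)h_{j-1}(y)\cdots h_i(y)$.
   Context: Let $\beta$ be an indeterminate. $W$ is a Weyl group of type $A$, $B$, $C$ or $D$ containing the simple reflections $s_i=(i,i+1)$, $i\ge1$ (with $s_is_{i+1}$ of order $3$ and $s_is_k$ of order $2$ for $|i-k|>1$). The IdCoxeter algebra $\mathrm{Id}_\beta(W)$ is the $\mathbb Z[\beta]$-algebra generated by $u_s$ ($s$ simple), with $u_s^2=\beta u_s$ and the braid relations $u_su_tu_s\cdots=u_tu_su_t\cdots$ ($m_{st}$ factors, $m_{st}$ the order of $st$). The variables $x,y$ commute with all $u_i$, and $h_i(x)=1+xu_i$. -}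

module Defs where

open import Level using (Level)
open import Algebra.Bundles using (Ring)
open import Data.Nat using (ℕ; zero; suc; _≤_)
import Data.Nat as ℕ

-- Within a (not necessarily commutative) ring R we describe the relevant
-- data of Id_β(W)[x,y]: the scalar β, the variables x, y (all central),
-- and the generators u_i for the simple reflections s_i = (i,i+1),
-- 1 ≤ i ≤ N, subject to the IdCoxeter relations among them:
--   u_i² = β u_i,  u_i u_{i+1} u_i = u_{i+1} u_i u_{i+1},
--   u_i u_k = u_k u_i for |i - k| > 1.
-- Id_β(W)[x,y] itself (for W of type A,B,C,D containing s_1..s_N) is an
-- instance, and any identity holding in every instance holds there.
record IdCoxeterData {c ℓ : Level} (R : Ring c ℓ) (N : ℕ) : Set (c Level.⊔ ℓ) where
  open Ring R
  field
    β x y : Carrier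
    u : ℕ → Carrier
    β-central : ∀ a → β * a ≈ a * β
    x-central : ∀ a → x * a ≈ a * x
    y-central : ∀ a → y * a ≈ a * y
    u-idem : ∀ i → 1 ≤ i → i ≤ N → u i * u i ≈ β * u i
    u-braid : ∀ i → 1 ≤ i → suc i ≤ N →
      u i * u (suc i) * u i ≈ u (suc i) * u i * u (suc i)
    u-comm : ∀ i k → 1 ≤ i → suc (suc i) ≤ k → k ≤ N →
      u i * u k ≈ u k * u i

module _ {c ℓ : Level} (R : Ring c ℓ) where
  open Ring R

  h : (ℕ → Carrier) → Carrier → ℕ → Carrier
  h u z i = 1# + z * u i

  ascProd : (ℕ → Carrier) → ℕ → ℕ → Carrier
  ascProd f i zero = f i
  ascProd f i (suc d) = f i * ascProd f (suc i) d

  descProd : (ℕ → Carrier) → ℕ → ℕ → Carrier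
  descProd f i zero = f i
  descProd f i (suc d) = f (i ℕ.+ suc d) * descProd f i d

  -- [i,j]_z with j = i + d : h_i(z) h_{i+1}(z) ... h_j(z)
  incSeg : (ℕ → Carrier) → Carrier → ℕ → ℕ → Carrier
  incSeg u z i d = ascProd (h u z) i d

  -- [j,i]_z with j = i + d : h_j(z) h_{j-1}(z) ... h_i(z)
  decSeg : (ℕ → Carrier) → Carrier → ℕ → ℕ → Carrier
  decSeg u z i d = descProd (h u z) i d

-- With x ⊕ y = x + y + βxy one has h_k(x) h_k(y) = h_k(x ⊕ y), because u_k² = βu_k; in
-- particular h_k(x) and h_k(y) commute. The braid relation gives the Yang–Baxter equation
-- h_k(x) h_{k+1}(x ⊕ y) h_k(y) = h_{k+1}(y) h_k(x ⊕ y) h_{k+1}(x), which together with the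
-- merge rule reads h_k(x) h_{k+1}(x) · h_{k+1}(y) h_k(y) = h_{k+1}(y) · h_k(x) h_k(y) · h_{k+1}(x).
-- Since the rest of [i,j-1]_x and [j-1,i]_y commutes with h_j, this peels h_j off:
-- [i,j]_x [j,i]_y = h_j(y) · [i,j-1]_x [j-1,i]_y · h_j(x), and induction on j - i
-- lets [i,j]_x and [j,i]_y swap.
module Submission where

open import Defs
open import Level using (Level)
open import Algebra.Bundles using (Ring)
open import Data.Nat using (ℕ; zero; suc; _≤_; s≤s; z≤n)
import Data.Nat as ℕ
import Data.Nat.Properties as ℕ
import Relation.Binary.PropositionalEquality as ≡
import Algebra.Solver.Monoid as MonoidSolver
import Algebra.Solver.CommutativeMonoid as CommutativeMonoidSolver
import Relation.Binary.Reasoning.Setoid as SetoidReasoning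

module _ {r ℓ : Level} (R : Ring r ℓ) where
  open Ring R hiding (zero)
  open SetoidReasoning setoid

  Commute : Carrier → Carrier → Set ℓ
  Commute a b = a * b ≈ b * a

  Central : Carrier → Set (r Level.⊔ ℓ)
  Central a = ∀ b → Commute a b

  commute-1 : ∀ {t} → Commute t 1#
  commute-1 {t} = trans (*-identityʳ t) (sym (*-identityˡ t))

  commute-+ : ∀ {t a b} → Commute t a → Commute t b → Commute t (a + b)
  commute-+ {t} {a} {b} ta tb = begin
    t * (a + b)    ≈⟨ distribˡ t a b ⟩
    t * a + t * b  ≈⟨ +-cong ta tb ⟩
    a * t + b * t  ≈⟨ distribʳ t a b ⟨
    (a + b) * t    ∎

  commute-* : ∀ {t a b} → Commute t a → Commute t b → Commute t (a * b)
  commute-* {t} {a} {b} ta tb = begin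
    t * (a * b)  ≈⟨ *-assoc t a b ⟨
    (t * a) * b  ≈⟨ *-congʳ ta ⟩
    (a * t) * b  ≈⟨ *-assoc a t b ⟩
    a * (t * b)  ≈⟨ *-congˡ tb ⟩
    a * (b * t)  ≈⟨ *-assoc a b t ⟨
    (a * b) * t  ∎

  central-+ : ∀ {a b} → Central a → Central b → Central (a + b)
  central-+ ca cb t = sym (commute-+ (sym (ca t)) (sym (cb t)))

  central-* : ∀ {a b} → Central a → Central b → Central (a * b)
  central-* ca cb t = sym (commute-* (sym (ca t)) (sym (cb t)))

  commute-h : ∀ {t a} z → Central z → Commute t a → Commute t (1# + z * a)
  commute-h z cz ta = commute-+ commute-1 (commute-* (sym (cz _)) ta)

  scaled-* : ∀ a {b} s t → Central b → (a * s) * (b * t) ≈ (a * b) * (s * t)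
  scaled-* a {b} s t cb = begin
    (a * s) * (b * t)  ≈⟨ *-assoc a s (b * t) ⟩
    a * (s * (b * t))  ≈⟨ *-congˡ (*-assoc s b t) ⟨
    a * ((s * b) * t)  ≈⟨ *-congˡ (*-congʳ (cb s)) ⟨
    a * ((b * s) * t)  ≈⟨ *-congˡ (*-assoc b s t) ⟩
    a * (b * (s * t))  ≈⟨ *-assoc a b (s * t) ⟨
    (a * b) * (s * t)  ∎

  expand-1+ : ∀ a r → a * (1# + r) ≈ a + a * r
  expand-1+ a r = trans (distribˡ a 1# r) (+-congʳ (*-identityʳ a))

  expand-1+² : ∀ p q → (1# + p) * (1# + q) ≈ (1# + q) + (p + p * q)
  expand-1+² p q = trans (distribʳ (1# + q) 1# p) (+-cong (*-identityˡ _) (expand-1+ p q))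

  -- p and r are grouped together because in the Yang–Baxter equation they get merged.
  expand-1+³ : ∀ p q r → (1# + p) * (1# + q) * (1# + r) ≈
    1# + (p + r + p * r) + q + p * q + q * r + p * q * r
  expand-1+³ p q r = begin
    (1# + p) * (1# + q) * (1# + r)
      ≈⟨ *-congʳ (expand-1+² p q) ⟩
    ((1# + q) + (p + p * q)) * (1# + r)
      ≈⟨ distribʳ (1# + r) (1# + q) (p + p * q) ⟩
    (1# + q) * (1# + r) + (p + p * q) * (1# + r)
      ≈⟨ +-cong (expand-1+² q r) (trans (distribʳ (1# + r) p (p * q))
                                         (+-cong (expand-1+ p r) (expand-1+ (p * q) r))) ⟩
    ((1# + r) + (q + q * r)) + ((p + p * r) + (p * q + p * q * r))
      ≈⟨ solve 8 (λ o p r q qr pr pq pqr →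
                    ((o ⊞ r) ⊞ (q ⊞ qr)) ⊞ ((p ⊞ pr) ⊞ (pq ⊞ pqr)) ⊜
                    ((((o ⊞ ((p ⊞ r) ⊞ pr)) ⊞ q) ⊞ pq) ⊞ qr) ⊞ pqr)
                 refl 1# p r q (q * r) (p * r) (p * q) (p * q * r) ⟩
    1# + (p + r + p * r) + q + p * q + q * r + p * q * r ∎
    where open CommutativeMonoidSolver +-commutativeMonoid renaming (_⊕_ to _⊞_)

  exchange-extend : ∀ {A B X X′ Y Y′} → Commute Y A → Commute X B →
    (X′ * X) * (Y * Y′) ≈ Y * (X′ * Y′) * X →
    ((A * X′) * X) * (Y * (Y′ * B)) ≈ Y * ((A * X′) * (Y′ * B)) * X
  exchange-extend {A} {B} {X} {X′} {Y} {Y′} YA XB exchange = begin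
    ((A * X′) * X) * (Y * (Y′ * B))
      ≈⟨ solve 6 (λ a x′ x y y′ b → ((a ⊕ x′) ⊕ x) ⊕ (y ⊕ (y′ ⊕ b)) ⊜
                                     (a ⊕ ((x′ ⊕ x) ⊕ (y ⊕ y′))) ⊕ b) refl A X′ X Y Y′ B ⟩
    A * ((X′ * X) * (Y * Y′)) * B    ≈⟨ *-congʳ (*-congˡ exchange) ⟩
    A * (Y * (X′ * Y′) * X) * B
      ≈⟨ solve 6 (λ a x′ x y y′ b → (a ⊕ ((y ⊕ (x′ ⊕ y′)) ⊕ x)) ⊕ b ⊜
                                     ((a ⊕ y) ⊕ (x′ ⊕ y′)) ⊕ (x ⊕ b)) refl A X′ X Y Y′ B ⟩
    ((A * Y) * (X′ * Y′)) * (X * B)  ≈⟨ *-cong (*-congʳ (sym YA)) XB ⟩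
    ((Y * A) * (X′ * Y′)) * (B * X)
      ≈⟨ solve 6 (λ a x′ x y y′ b → ((y ⊕ a) ⊕ (x′ ⊕ y′)) ⊕ (b ⊕ x) ⊜
                                     (y ⊕ ((a ⊕ x′) ⊕ (y′ ⊕ b))) ⊕ x) refl A X′ X Y Y′ B ⟩
    Y * ((A * X′) * (Y′ * B)) * X    ∎
    where open MonoidSolver *-monoid

  ascProd-snoc : ∀ f i d → ascProd R f i (suc d) ≈ ascProd R f i d * f (i ℕ.+ suc d)
  ascProd-snoc f i zero = *-congˡ (reflexive (≡.cong f (ℕ.+-comm 1 i)))
  ascProd-snoc f i (suc d) = begin
    f i * ascProd R f (suc i) (suc d)
      ≈⟨ *-congˡ (ascProd-snoc f (suc i) d) ⟩
    f i * (ascProd R f (suc i) d * f (suc i ℕ.+ suc d))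
      ≈⟨ *-assoc _ _ _ ⟨
    ascProd R f i (suc d) * f (suc i ℕ.+ suc d)
      ≈⟨ *-congˡ (reflexive (≡.cong f (ℕ.+-suc i (suc d)))) ⟨
    ascProd R f i (suc d) * f (i ℕ.+ suc (suc d)) ∎

  ascProd-commute : ∀ {t} f i d → (∀ k → i ≤ k → k ≤ i ℕ.+ d → Commute t (f k)) →
    Commute t (ascProd R f i d)
  ascProd-commute f i zero tf = tf i ℕ.≤-refl (ℕ.m≤m+n i 0)
  ascProd-commute f i (suc d) tf = commute-* (tf i ℕ.≤-refl (ℕ.m≤m+n i (suc d)))
    (ascProd-commute f (suc i) d λ k i<k k≤1+i+d →
      tf k (ℕ.<⇒≤ i<k) (ℕ.≤-trans k≤1+i+d (ℕ.≤-reflexive (≡.sym (ℕ.+-suc i d)))))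

  descProd-commute : ∀ {t} f i d → (∀ k → i ≤ k → k ≤ i ℕ.+ d → Commute t (f k)) →
    Commute t (descProd R f i d)
  descProd-commute f i zero tf = tf i ℕ.≤-refl (ℕ.m≤m+n i 0)
  descProd-commute f i (suc d) tf = commute-* (tf (i ℕ.+ suc d) (ℕ.m≤m+n i (suc d)) ℕ.≤-refl)
    (descProd-commute f i d λ k i≤k k≤i+d →
      tf k i≤k (ℕ.≤-trans k≤i+d (ℕ.+-monoʳ-≤ i (ℕ.n≤1+n d))))

  module _ (β : Carrier) (β-central : Central β) where

    infixl 6 _⊕_
    _⊕_ : Carrier → Carrier → Carrier
    a ⊕ b = a + b + a * b * β

    ⊕-central : ∀ {a b} → Central a → Central b → Central (a ⊕ b)
    ⊕-central ca cb = central-+ (central-+ ca cb) (central-* (central-* ca cb) β-central)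

    ⊕-comm : ∀ a {b} → Central b → a ⊕ b ≈ b ⊕ a
    ⊕-comm a cb = +-cong (+-comm a _) (*-congʳ (sym (cb a)))

    scaled-merge : ∀ {w} → w * w ≈ β * w → ∀ a {b} → Central b →
      a * w + b * w + (a * w) * (b * w) ≈ (a ⊕ b) * w
    scaled-merge {w} ww a {b} cb = begin
      a * w + b * w + (a * w) * (b * w)   ≈⟨ +-congˡ (scaled-* a w w cb) ⟩
      a * w + b * w + (a * b) * (w * w)   ≈⟨ +-congˡ (*-congˡ ww) ⟩
      a * w + b * w + (a * b) * (β * w)   ≈⟨ +-congˡ (*-assoc (a * b) β w) ⟨
      a * w + b * w + (a * b * β) * w     ≈⟨ +-congʳ (distribʳ w a b) ⟨
      (a + b) * w + (a * b * β) * w       ≈⟨ distribʳ w (a + b) (a * b * β) ⟨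
      (a ⊕ b) * w                         ∎

    h-merge : ∀ {w} → w * w ≈ β * w → ∀ a {b} → Central b →
      (1# + a * w) * (1# + b * w) ≈ 1# + (a ⊕ b) * w
    h-merge {w} ww a {b} cb = begin
      (1# + a * w) * (1# + b * w)                ≈⟨ expand-1+² (a * w) (b * w) ⟩
      (1# + b * w) + (a * w + (a * w) * (b * w))
        ≈⟨ solve 4 (λ o p q pq → (o ⊞ q) ⊞ (p ⊞ pq) ⊜ o ⊞ ((p ⊞ q) ⊞ pq))
                   refl 1# (a * w) (b * w) ((a * w) * (b * w)) ⟩
      1# + (a * w + b * w + (a * w) * (b * w))   ≈⟨ +-congˡ (scaled-merge ww a cb) ⟩
      1# + (a ⊕ b) * w                           ∎
      where open CommutativeMonoidSolver +-commutativeMonoid renaming (_⊕_ to _⊞_)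

    h-commute : ∀ {w} → w * w ≈ β * w → ∀ {a b} → Central a → Central b →
      Commute (1# + a * w) (1# + b * w)
    h-commute {w} ww {a} {b} ca cb = begin
      (1# + a * w) * (1# + b * w)  ≈⟨ h-merge ww a cb ⟩
      1# + (a ⊕ b) * w             ≈⟨ +-congˡ (*-congʳ (⊕-comm a cb)) ⟩
      1# + (b ⊕ a) * w             ≈⟨ h-merge ww b ca ⟨
      (1# + b * w) * (1# + a * w)  ∎

    yang-baxter-expand : ∀ {u} → u * u ≈ β * u → ∀ v x {y c} → Central y → Central c →
      (1# + x * u) * (1# + c * v) * (1# + y * u) ≈
        1# + (x ⊕ y) * u + c * v + (x * c) * (u * v) + (c * y) * (v * u)
           + ((x * c) * y) * ((u * v) * u)
    yang-baxter-expand {u} uu v x {y} {c} cy cc = trans (expand-1+³ (x * u) (c * v) (y * u))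
      (+-cong (+-cong (+-cong (+-congʳ (+-congˡ (scaled-merge uu x cy)))
                              (scaled-* x u v cc))
                      (scaled-* c v u cy))
              (trans (*-congʳ (scaled-* x u v cc)) (scaled-* (x * c) (u * v) u cy)))

    yang-baxter : ∀ {u v} → u * u ≈ β * u → v * v ≈ β * v → u * v * u ≈ v * u * v →
      ∀ {x y} → Central x → Central y →
      (1# + x * u) * (1# + (x ⊕ y) * v) * (1# + y * u) ≈
        (1# + y * v) * (1# + (x ⊕ y) * u) * (1# + x * v)
    yang-baxter {u} {v} uu vv braid {x} {y} cx cy = begin
      (1# + x * u) * (1# + c * v) * (1# + y * u)
        ≈⟨ yang-baxter-expand uu v x cy cc ⟩
      1# + c * u + c * v + (x * c) * (u * v) + (c * y) * (v * u)
         + ((x * c) * y) * ((u * v) * u)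
        ≈⟨ solve 6 (λ o cu cv p q r → ((((o ⊞ cu) ⊞ cv) ⊞ p) ⊞ q) ⊞ r ⊜
                                       ((((o ⊞ cv) ⊞ cu) ⊞ q) ⊞ p) ⊞ r)
                   refl 1# (c * u) (c * v) ((x * c) * (u * v)) ((c * y) * (v * u))
                   (((x * c) * y) * ((u * v) * u)) ⟩
      1# + c * v + c * u + (c * y) * (v * u) + (x * c) * (u * v)
         + ((x * c) * y) * ((u * v) * u)
        ≈⟨ +-cong (+-cong (+-cong (+-congʳ (+-congˡ (*-congʳ (⊕-comm x cy))))
                                  (*-congʳ (sym (cy c))))
                          (*-congʳ (cx c)))
                  (*-cong scalar braid) ⟩
      1# + (y ⊕ x) * v + c * u + (y * c) * (v * u) + (c * x) * (u * v)
         + ((y * c) * x) * ((v * u) * v)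
        ≈⟨ yang-baxter-expand vv u y cx cc ⟨
      (1# + y * v) * (1# + c * u) * (1# + x * v) ∎
      where
      open CommutativeMonoidSolver +-commutativeMonoid renaming (_⊕_ to _⊞_)
      c = x ⊕ y
      cc : Central c
      cc = ⊕-central cx cy
      scalar : (x * c) * y ≈ (y * c) * x
      scalar = begin
        (x * c) * y  ≈⟨ cy (x * c) ⟨
        y * (x * c)  ≈⟨ *-congˡ (cx c) ⟩
        y * (c * x)  ≈⟨ *-assoc y c x ⟨
        (y * c) * x  ∎

    h-exchange : ∀ {u v} → u * u ≈ β * u → v * v ≈ β * v → u * v * u ≈ v * u * v →
      ∀ {x y} → Central x → Central y →
      ((1# + x * u) * (1# + x * v)) * ((1# + y * v) * (1# + y * u)) ≈
        (1# + y * v) * ((1# + x * u) * (1# + y * u)) * (1# + x * v)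
    h-exchange {u} {v} uu vv braid {x} {y} cx cy = begin
      (Xu * Xv) * (Yv * Yu)    ≈⟨ *-assoc (Xu * Xv) Yv Yu ⟨
      ((Xu * Xv) * Yv) * Yu    ≈⟨ *-congʳ (*-assoc Xu Xv Yv) ⟩
      (Xu * (Xv * Yv)) * Yu    ≈⟨ *-congʳ (*-congˡ (h-merge vv x cy)) ⟩
      Xu * (1# + (x ⊕ y) * v) * Yu  ≈⟨ yang-baxter uu vv braid cx cy ⟩
      Yv * (1# + (x ⊕ y) * u) * Xv  ≈⟨ *-congʳ (*-congˡ (h-merge uu x cy)) ⟨
      Yv * (Xu * Yu) * Xv      ∎
      where
      Xu = 1# + x * u
      Xv = 1# + x * v
      Yu = 1# + y * u
      Yv = 1# + y * v

  module _ {N : ℕ} (D : IdCoxeterData R N) where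
    open IdCoxeterData D

    h-far-commute : ∀ {z w} → Central z → Central w → ∀ {m k} →
      1 ≤ m → suc (suc m) ≤ k → k ≤ N → Commute (h R u z k) (h R u w m)
    h-far-commute {z} {w} cz cw 1≤m m+2≤k k≤N =
      commute-h w cw (sym (commute-h z cz (u-comm _ _ 1≤m m+2≤k k≤N)))

    incSeg-far-commute : ∀ {z w} → Central z → Central w → ∀ {i d k} →
      1 ≤ i → suc (suc (i ℕ.+ d)) ≤ k → k ≤ N → Commute (h R u z k) (incSeg R u w i d)
    incSeg-far-commute cz cw {i} {d} 1≤i i+d+2≤k k≤N =
      ascProd-commute (h R u _) i d λ m i≤m m≤i+d →
        h-far-commute cz cw (ℕ.≤-trans 1≤i i≤m) (ℕ.≤-trans (s≤s (s≤s m≤i+d)) i+d+2≤k) k≤N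

    decSeg-far-commute : ∀ {z w} → Central z → Central w → ∀ {i d k} →
      1 ≤ i → suc (suc (i ℕ.+ d)) ≤ k → k ≤ N → Commute (h R u z k) (decSeg R u w i d)
    decSeg-far-commute cz cw {i} {d} 1≤i i+d+2≤k k≤N =
      descProd-commute (h R u _) i d λ m i≤m m≤i+d →
        h-far-commute cz cw (ℕ.≤-trans 1≤i i≤m) (ℕ.≤-trans (s≤s (s≤s m≤i+d)) i+d+2≤k) k≤N

    X Y : ℕ → Carrier
    X = h R u x
    Y = h R u y

    h-exchange-at : ∀ k → 1 ≤ k → suc k ≤ N →
      (X k * X (suc k)) * (Y (suc k) * Y k) ≈ Y (suc k) * (X k * Y k) * X (suc k)
    h-exchange-at k 1≤k k+1≤N = h-exchange β β-central
      (u-idem k 1≤k (ℕ.≤-trans (ℕ.n≤1+n k) k+1≤N)) (u-idem (suc k) (s≤s z≤n) k+1≤N)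
      (u-braid k 1≤k k+1≤N) x-central y-central

    segments-peel : ∀ i d → 1 ≤ i → i ℕ.+ suc d ≤ N →
      (incSeg R u x i d * X (i ℕ.+ suc d)) * (Y (i ℕ.+ suc d) * decSeg R u y i d) ≈
        Y (i ℕ.+ suc d) * (incSeg R u x i d * decSeg R u y i d) * X (i ℕ.+ suc d)
    segments-peel i zero 1≤i i+1≤N rewrite ℕ.+-comm i 1 = h-exchange-at i 1≤i i+1≤N
    segments-peel i (suc d) 1≤i j≤N rewrite ℕ.+-suc i (suc d) = begin
      (incSeg R u x i (suc d) * X j) * (Y j * (Y j′ * B))
        ≈⟨ *-congʳ (*-congʳ (ascProd-snoc X i d)) ⟩
      ((A * X j′) * X j) * (Y j * (Y j′ * B))
        ≈⟨ exchange-extend (incSeg-far-commute y-central x-central 1≤i i+d+2≤j j≤N)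
                           (decSeg-far-commute x-central y-central 1≤i i+d+2≤j j≤N)
                           (h-exchange-at j′ (ℕ.≤-trans 1≤i (ℕ.m≤m+n i (suc d))) j≤N) ⟩
      Y j * ((A * X j′) * (Y j′ * B)) * X j
        ≈⟨ *-congʳ (*-congˡ (*-congʳ (ascProd-snoc X i d))) ⟨
      Y j * (incSeg R u x i (suc d) * (Y j′ * B)) * X j ∎
      where
      j′ = i ℕ.+ suc d
      j = suc j′
      A = incSeg R u x i d
      B = decSeg R u y i d
      i+d+2≤j : suc (suc (i ℕ.+ d)) ≤ j
      i+d+2≤j = ℕ.≤-reflexive (≡.cong suc (≡.sym (ℕ.+-suc i d)))

    segments-commute : ∀ i d → 1 ≤ i → i ℕ.+ d ≤ N →
      Commute (incSeg R u x i d) (decSeg R u y i d)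
    segments-commute i zero 1≤i i+0≤N = h-commute β β-central
      (u-idem i 1≤i (≡.subst (_≤ N) (ℕ.+-identityʳ i) i+0≤N)) x-central y-central
    segments-commute i (suc d) 1≤i j≤N = begin
      incSeg R u x i (suc d) * (Y j * B)  ≈⟨ *-congʳ (ascProd-snoc X i d) ⟩
      (A * X j) * (Y j * B)               ≈⟨ segments-peel i d 1≤i j≤N ⟩
      Y j * (A * B) * X j                 ≈⟨ *-congʳ (*-congˡ (segments-commute i d 1≤i i+d≤N)) ⟩
      Y j * (B * A) * X j                 ≈⟨ *-assoc (Y j) (B * A) (X j) ⟩
      Y j * ((B * A) * X j)               ≈⟨ *-congˡ (*-assoc B A (X j)) ⟩
      Y j * (B * (A * X j))               ≈⟨ *-assoc (Y j) B (A * X j) ⟨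
      (Y j * B) * (A * X j)               ≈⟨ *-congˡ (ascProd-snoc X i d) ⟨
      (Y j * B) * incSeg R u x i (suc d)  ∎
      where
      j = i ℕ.+ suc d
      A = incSeg R u x i d
      B = decSeg R u y i d
      i+d≤N : i ℕ.+ d ≤ N
      i+d≤N = ℕ.≤-trans (ℕ.+-monoʳ-≤ i (ℕ.n≤1+n d)) j≤N

lemma2 : ∀ {c ℓ} (R : Ring c ℓ) (N : ℕ) (D : IdCoxeterData R N) →
    ∀ (i d : ℕ) → 1 ≤ i → i ℕ.+ d ≤ N →
      let open Ring R
          open IdCoxeterData D
      in incSeg R u x i d * decSeg R u y i d ≈ decSeg R u y i d * incSeg R u x i d
lemma2 R N D = segments-commute R D
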